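{- Let $p\ge 2$ and let $cit_1\ge cit_2\ge\dots\ge cit_p\ge 1$ be integers, and adopt the convention $cit_j=0$ for $j>p$. For $k\in\{0,1,\dots,p-1\}$ let $h_k$ be the shifted $h$-index of order $k$, i.e. $h_k=\max\{m\ge 1: cit_{k+m}\ge m,\ k+m\le p\}$. Then for each $k\in\{0,1,\dots,p-2\}$: $$h_k-1\le h_{k+1}\le h_k .$$ Furthermore, $h_{k+1}=h_k$ if and only if $cit_{k+1+h_k}=h_k$, and $h_{k+1}=h_k-1$ if and only if $cit_{k+1+h_k}<h_k$.
   Context: The numbers $cit_1,\dots,cit_p$ are the citation counts of the $p$ publications of a researcher, ranked in non-increasing order, each at least $1$. The $h$-index of a non-increasing finite sequence $a_1\ge\dots\ge a_n$ is $\max\{m: a_m\ge m,\ 1\le m\le n\}$. The shifted $h$-index of order $k$, $h_k$, is the $h$-index of the sequence $cit_{k+1},cit_{k+2},\dots,cit_p$; thus $h_0$ is the usual $h$-index. -}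

module Defs where

open import Data.Nat using (ℕ; zero; suc; _+_; _∸_; _≤_; _≤?_)
open import Relation.Nullary using (yes; no)

-- h-index of the finite sequence a 1, a 2, …, a n (entries a m for 1 ≤ m ≤ n):
--   hIndex a n = max { m : 1 ≤ m ≤ n , m ≤ a m }   (0 if the set is empty).
hIndex : (ℕ → ℕ) → ℕ → ℕ
hIndex a zero = zero
hIndex a (suc n) with suc n ≤? a (suc n)
... | yes _ = suc n
... | no  _ = hIndex a n

shiftedH : (ℕ → ℕ) → ℕ → ℕ → ℕ
shiftedH cit p k = hIndex (λ m → cit (k + m)) (p ∸ k)

-- Let h be the h-index of a non-increasing sequence a₁ ≥ a₂ ≥ … and h′ that of a₂ ≥ a₃ ≥ ….
-- The entries a₂, …, a_h still have at least h - 1 citations, so h′ ≥ h - 1; and the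
-- maximality of h gives a_{h+1} ≤ h, so every later entry of the shifted sequence is too
-- small to push h′ beyond h.
module Submission where

open import Defs
open import Data.Nat using (ℕ; zero; suc; _+_; _∸_; _≤_; _<_; z≤n; s≤s; _≤?_; _≟_)
open import Data.Nat.Properties
open import Data.Product using (_×_; _,_)
open import Data.Sum using (inj₁; inj₂)
open import Data.Empty using (⊥-elim)
open import Function.Base using (_∘_)
open import Function.Bundles using (_⇔_; mk⇔; module Equivalence)
open import Relation.Nullary using (yes; no)
open import Relation.Binary.PropositionalEquality
  using (_≡_; refl; sym; trans; cong; subst; subst₂)

hIndex-≤ : ∀ a n → hIndex a n ≤ n
hIndex-≤ a zero = z≤n
hIndex-≤ a (suc n) with suc n ≤? a (suc n)
... | yes _ = ≤-refl
... | no  _ = m≤n⇒m≤1+n (hIndex-≤ a n)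

hIndex-sound : ∀ a n → 1 ≤ hIndex a n → hIndex a n ≤ a (hIndex a n)
hIndex-sound a (suc n) 1≤h with suc n ≤? a (suc n)
... | yes n+1≤a = n+1≤a
... | no  _     = hIndex-sound a n 1≤h

hIndex-greatest : ∀ a n m → m ≤ n → m ≤ a m → m ≤ hIndex a n
hIndex-greatest a zero    m m≤0 _ = m≤0
hIndex-greatest a (suc n) m m≤n+1 m≤a with suc n ≤? a (suc n)
... | yes _ = m≤n+1
... | no n+1≰a with m ≟ suc n
...   | yes refl = ⊥-elim (n+1≰a m≤a)
...   | no  m≢n+1 = hIndex-greatest a n m (≤-pred (≤∧≢⇒< m≤n+1 m≢n+1)) m≤a

hIndex-maximal : ∀ a n m → hIndex a n < m → m ≤ n → a m < m
hIndex-maximal a zero    m h<m m≤0 = ⊥-elim (<⇒≱ h<m m≤0)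
hIndex-maximal a (suc n) m h<m m≤n+1 with suc n ≤? a (suc n)
... | yes _ = ⊥-elim (<⇒≱ h<m m≤n+1)
... | no n+1≰a with m ≟ suc n
...   | yes refl = ≰⇒> n+1≰a
...   | no  m≢n+1 = hIndex-maximal a n m h<m (≤-pred (≤∧≢⇒< m≤n+1 m≢n+1))

hIndex-least : ∀ a n x → (∀ m → x < m → m ≤ n → a m < m) → hIndex a n ≤ x
hIndex-least a zero    x _ = z≤n
hIndex-least a (suc n) x small with suc n ≤? a (suc n)
... | yes n+1≤a = ≮⇒≥ (λ x<n+1 → <⇒≱ (small (suc n) x<n+1 ≤-refl) n+1≤a)
... | no  _     = hIndex-least a n x (λ m x<m m≤n → small m x<m (m≤n⇒m≤1+n m≤n))

hIndex-cong : ∀ {a b} n → (∀ m → a m ≡ b m) → hIndex a n ≡ hIndex b n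
hIndex-cong         zero    a≗b = refl
hIndex-cong {a} {b} (suc n) a≗b with suc n ≤? a (suc n) | suc n ≤? b (suc n)
... | yes _     | yes _     = refl
... | no  _     | no  _     = hIndex-cong n a≗b
... | yes n+1≤a | no  n+1≰b = ⊥-elim (n+1≰b (subst (suc n ≤_) (a≗b (suc n)) n+1≤a))
... | no  n+1≰a | yes n+1≤b = ⊥-elim (n+1≰a (subst (suc n ≤_) (sym (a≗b (suc n))) n+1≤b))

AntitoneOn : (ℕ → ℕ) → ℕ → Set
AntitoneOn a n = ∀ i j → 1 ≤ i → i ≤ j → j ≤ n → a j ≤ a i

HIndexStep : ℕ → ℕ → ℕ → Set
HIndexStep h h′ c =
  ((h ∸ 1 ≤ h′) × (h′ ≤ h)) × ((h′ ≡ h) ⇔ (c ≡ h)) × ((h′ ≡ h ∸ 1) ⇔ (c < h))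

module DropHead (a : ℕ → ℕ) (n : ℕ) (antitone : AntitoneOn a (suc n))
                (head-pos : 1 ≤ a 1) (vanishing : a (2 + n) ≡ 0) where

  h h′ : ℕ
  h  = hIndex a (suc n)
  h′ = hIndex (a ∘ suc) n

  1≤h : 1 ≤ h
  1≤h = hIndex-greatest a (suc n) 1 (s≤s z≤n) head-pos

  h≤a[h] : h ≤ a h
  h≤a[h] = hIndex-sound a (suc n) 1≤h

  a[1+h]≤h : a (suc h) ≤ h
  a[1+h]≤h with m≤n⇒m<n∨m≡n (hIndex-≤ a (suc n))
  ... | inj₁ h<n+1 = ≤-pred (hIndex-maximal a (suc n) (suc h) ≤-refl h<n+1)
  ... | inj₂ h≡n+1 = subst (_≤ h) (sym (trans (cong (a ∘ suc) h≡n+1) vanishing)) z≤n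

  h≤n : 1 ≤ a (suc h) → h ≤ n
  h≤n 1≤a[1+h] with m≤n⇒m<n∨m≡n (hIndex-≤ a (suc n))
  ... | inj₁ h<n+1 = ≤-pred h<n+1
  ... | inj₂ h≡n+1 =
    ⊥-elim (<⇒≱ 1≤a[1+h] (≤-reflexive (trans (cong (a ∘ suc) h≡n+1) vanishing)))

  h∸1≤h′ : h ∸ 1 ≤ h′
  h∸1≤h′ = hIndex-greatest (a ∘ suc) n (h ∸ 1) (∸-monoˡ-≤ 1 (hIndex-≤ a (suc n)))
                           (shift-down 1≤h h≤a[h])
    where
    shift-down : ∀ {m} → 1 ≤ m → m ≤ a m → m ∸ 1 ≤ a (suc (m ∸ 1))
    shift-down {suc m} _ m+1≤a = ≤-trans (n≤1+n m) m+1≤a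

  h′≤h : h′ ≤ h
  h′≤h = hIndex-least (a ∘ suc) n h λ m h<m m≤n →
    ≤-<-trans (≤-trans (antitone (suc h) (suc m) (s≤s z≤n) (s≤s (<⇒≤ h<m)) (s≤s m≤n))
                       a[1+h]≤h)
              h<m

  h′≡h⇔ : (h′ ≡ h) ⇔ (a (suc h) ≡ h)
  h′≡h⇔ = mk⇔ to from
    where
    to : h′ ≡ h → a (suc h) ≡ h
    to h′≡h = ≤-antisym a[1+h]≤h
      (subst (λ x → x ≤ a (suc x)) h′≡h
             (hIndex-sound (a ∘ suc) n (subst (1 ≤_) (sym h′≡h) 1≤h)))
    from : a (suc h) ≡ h → h′ ≡ h
    from a[1+h]≡h = ≤-antisym h′≤h
      (hIndex-greatest (a ∘ suc) n h (h≤n (subst (1 ≤_) (sym a[1+h]≡h) 1≤h))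
                       (≤-reflexive (sym a[1+h]≡h)))

  h′≡h∸1⇔ : (h′ ≡ h ∸ 1) ⇔ (a (suc h) < h)
  h′≡h∸1⇔ = mk⇔ to from
    where
    open Equivalence h′≡h⇔ renaming (to to h′≡h⇒; from to ⇒h′≡h)
    to : h′ ≡ h ∸ 1 → a (suc h) < h
    to h′≡h∸1 = ≤∧≢⇒< a[1+h]≤h λ a[1+h]≡h →
      <-irrefl (trans (sym h′≡h∸1) (⇒h′≡h a[1+h]≡h)) (∸-monoʳ-< {o = 0} (s≤s z≤n) 1≤h)
    from : a (suc h) < h → h′ ≡ h ∸ 1
    from a[1+h]<h = ≤-antisym
      (∸-monoˡ-≤ 1 (≤∧≢⇒< h′≤h λ h′≡h → <-irrefl (h′≡h⇒ h′≡h) a[1+h]<h))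
      h∸1≤h′

  step : HIndexStep h h′ (a (suc h))
  step = (h∸1≤h′ , h′≤h) , h′≡h⇔ , h′≡h∸1⇔

hIndex-drop-head : ∀ a n → 1 ≤ n → AntitoneOn a n → 1 ≤ a 1 → a (suc n) ≡ 0
  → HIndexStep (hIndex a n) (hIndex (a ∘ suc) (n ∸ 1)) (a (suc (hIndex a n)))
hIndex-drop-head a (suc n) _ = DropHead.step a n

proposition4p7 : (p : ℕ) → 2 ≤ p → (cit : ℕ → ℕ)
    → (∀ i j → 1 ≤ i → i ≤ j → j ≤ p → cit j ≤ cit i)
    → (∀ i → 1 ≤ i → i ≤ p → 1 ≤ cit i)
    → (∀ j → p < j → cit j ≡ 0)
    → (k : ℕ) → k + 2 ≤ p
    → ((shiftedH cit p k ∸ 1 ≤ shiftedH cit p (k + 1))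
        × (shiftedH cit p (k + 1) ≤ shiftedH cit p k))
      × ((shiftedH cit p (k + 1) ≡ shiftedH cit p k)
          ⇔ (cit (k + 1 + shiftedH cit p k) ≡ shiftedH cit p k))
      × ((shiftedH cit p (k + 1) ≡ shiftedH cit p k ∸ 1)
          ⇔ (cit (k + 1 + shiftedH cit p k) < shiftedH cit p k))
proposition4p7 p _ cit antitone positive vanishing k k+2≤p =
  subst₂ (HIndexStep (shiftedH cit p k))
         (sym shiftedH-next) (sym (cong cit (+-assoc k 1 (shiftedH cit p k))))
         (hIndex-drop-head a (p ∸ k) (m<n⇒0<n∸m k<p) a-antitone
                           (positive (k + 1) (m≤n+m 1 k) (in-range (m<n⇒0<n∸m k<p)))
                           a-vanishing)
  where
  a : ℕ → ℕ
  a m = cit (k + m)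
  k<p : k < p
  k<p = <-≤-trans (m<m+n k (s≤s z≤n)) k+2≤p
  k+[p∸k]≡p : k + (p ∸ k) ≡ p
  k+[p∸k]≡p = m+[n∸m]≡n (<⇒≤ k<p)
  in-range : ∀ {j} → j ≤ p ∸ k → k + j ≤ p
  in-range j≤p∸k = ≤-trans (+-monoʳ-≤ k j≤p∸k) (≤-reflexive k+[p∸k]≡p)
  a-antitone : AntitoneOn a (p ∸ k)
  a-antitone i j 1≤i i≤j j≤p∸k =
    antitone (k + i) (k + j) (≤-trans 1≤i (m≤n+m i k)) (+-monoʳ-≤ k i≤j) (in-range j≤p∸k)
  a-vanishing : a (suc (p ∸ k)) ≡ 0
  a-vanishing = vanishing _ (≤-reflexive (sym (trans (+-suc k (p ∸ k)) (cong suc k+[p∸k]≡p))))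
  shiftedH-next : shiftedH cit p (k + 1) ≡ hIndex (a ∘ suc) (p ∸ k ∸ 1)
  shiftedH-next = trans (hIndex-cong (p ∸ (k + 1)) (cong cit ∘ +-assoc k 1))
                        (cong (hIndex (a ∘ suc)) (sym (∸-+-assoc p k 1)))
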